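{- (Soundness) Every sequent $\Gamma\Rightarrow\Sigma$ derivable in the sequent calculus $\mathfrak S$ is valid.
   Context: Formulas are built from a denumerable set of propositional variables with binary $\wedge,\vee$, unary $\neg,\nabla$ and constants $\bot,\top$. $\mathbb{S}_6$ is the algebra with universe $\{0,\tfrac13,N,B,\tfrac23,1\}$, lattice order $0<\tfrac13<N<\tfrac23<1$, $\tfrac13<B<\tfrac23$, $N,B$ incomparable; $\neg$ swaps $0\leftrightarrow1$, $\tfrac13\leftrightarrow\tfrac23$, fixes $N,B$; $\nabla0=0$, $\nabla x=1$ for $x\ne0$; homomorphisms from formulas send $\bot\mapsto0,\top\mapsto1$. A sequent is $\Gamma\Rightarrow\Sigma$ with $\Gamma,\Sigma$ finite sets of formulas; it is valid iff $h(\bigwedge\Gamma)\le h(\bigvee\Sigma)$ for every homomorphism $h$ into $\mathbb{S}_6$ (empty conjunction $\top$, empty disjunction $\bot$). For a set $\Sigma$, $\nabla\Sigma=\{\nabla\beta:\beta\in\Sigma\}$. The calculus $\mathfrak S$ has axioms $\alpha\Rightarrow\alpha$; $\bot\Rightarrow$; $\Rightarrow\top$; $\alpha\Rightarrow\nabla\alpha$; $\Rightarrow\nabla\alpha\vee\neg\nabla\alpha$; and rules (premises / conclusion): left weakening $\Gamma\Rightarrow\Sigma$ / $\Gamma,\alpha\Rightarrow\Sigma$; right weakening $\Gamma\Rightarrow\Sigma$ / $\Gamma\Rightarrow\Sigma,\alpha$; cut $\Gamma\Rightarrow\Sigma,\alpha$ and $\alpha,\Gamma\Rightarrow\Sigma$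 / $\Gamma\Rightarrow\Sigma$; $(\wedge\Rightarrow)$ $\Gamma,\alpha,\beta\Rightarrow\Sigma$ / $\Gamma,\alpha\wedge\beta\Rightarrow\Sigma$; $(\Rightarrow\wedge)$ $\Gamma\Rightarrow\Sigma,\alpha$ and $\Gamma\Rightarrow\Sigma,\beta$ / $\Gamma\Rightarrow\Sigma,\alpha\wedge\beta$; $(\vee\Rightarrow)$ $\Gamma,\alpha\Rightarrow\Sigma$ and $\Gamma,\beta\Rightarrow\Sigma$ / $\Gamma,\alpha\vee\beta\Rightarrow\Sigma$; $(\Rightarrow\vee)$ $\Gamma\Rightarrow\Sigma,\alpha,\beta$ / $\Gamma\Rightarrow\Sigma,\alpha\vee\beta$; $(\neg)$ $\alpha\Rightarrow\beta$ / $\neg\beta\Rightarrow\neg\alpha$; $(\neg\neg\Rightarrow)$ $\Gamma,\alpha\Rightarrow\Sigma$ / $\Gamma,\neg\neg\alpha\Rightarrow\Sigma$; $(\Rightarrow\neg\neg)$ $\Gamma\Rightarrow\alpha,\Sigma$ / $\Gamma\Rightarrow\neg\neg\alpha,\Sigma$; $(\nabla)$ $\Gamma,\alpha\Rightarrow\nabla\Sigma$ / $\Gamma,\nabla\alpha\Rightarrow\nabla\Sigma$; $(\neg\nabla\Rightarrow)$ $\Gamma,\neg\nabla\alpha\Rightarrow\Sigma$ / $\Gamma,\nabla\neg\nabla\alpha\Rightarrow\Sigma$. Derivability is the usual notion (derivation trees from axiom instances using these rules). -}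

module Defs where

open import Data.Nat using (ℕ)
open import Data.List using (List; []; _∷_; [_]; map; foldr)
open import Data.List.Membership.Propositional using (_∈_)
open import Data.Product using (_×_)
open import Relation.Binary.PropositionalEquality using (_≡_)

data Formula : Set where
  var  : ℕ → Formula
  _∧_  : Formula → Formula → Formula
  _∨_  : Formula → Formula → Formula
  ¬_   : Formula → Formula
  ∇_   : Formula → Formula
  ⊥f   : Formula
  ⊤f   : Formula

infixr 6 _∧_
infixr 5 _∨_
infix 8 ¬_ ∇_

data S6 : Set where
  s0 s⅓ sN sB s⅔ s1 : S6

-- lattice order: 0 < 1/3 < N < 2/3 < 1, 1/3 < B < 2/3, N and B incomparable
data _≤S_ : S6 → S6 → Set where
  refl≤ : ∀ {x} → x ≤S x
  0≤⅓ : s0 ≤S s⅓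
  0≤N : s0 ≤S sN
  0≤B : s0 ≤S sB
  0≤⅔ : s0 ≤S s⅔
  0≤1 : s0 ≤S s1
  ⅓≤N : s⅓ ≤S sN
  ⅓≤B : s⅓ ≤S sB
  ⅓≤⅔ : s⅓ ≤S s⅔
  ⅓≤1 : s⅓ ≤S s1
  N≤⅔ : sN ≤S s⅔
  N≤1 : sN ≤S s1
  B≤⅔ : sB ≤S s⅔
  B≤1 : sB ≤S s1
  ⅔≤1 : s⅔ ≤S s1

_⊓_ : S6 → S6 → S6
s0 ⊓ y  = s0
s⅓ ⊓ s0 = s0
s⅓ ⊓ y  = s⅓
sN ⊓ s0 = s0
sN ⊓ s⅓ = s⅓
sN ⊓ sN = sN
sN ⊓ sB = s⅓
sN ⊓ s⅔ = sN
sN ⊓ s1 = sN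
sB ⊓ s0 = s0
sB ⊓ s⅓ = s⅓
sB ⊓ sN = s⅓
sB ⊓ sB = sB
sB ⊓ s⅔ = sB
sB ⊓ s1 = sB
s⅔ ⊓ s1 = s⅔
s⅔ ⊓ y  = y
s1 ⊓ y  = y

_⊔_ : S6 → S6 → S6
s0 ⊔ y  = y
s⅓ ⊔ s0 = s⅓
s⅓ ⊔ y  = y
sN ⊔ s0 = sN
sN ⊔ s⅓ = sN
sN ⊔ sN = sN
sN ⊔ sB = s⅔
sN ⊔ s⅔ = s⅔
sN ⊔ s1 = s1
sB ⊔ s0 = sB
sB ⊔ s⅓ = sB
sB ⊔ sN = s⅔
sB ⊔ sB = sB
sB ⊔ s⅔ = s⅔
sB ⊔ s1 = s1
s⅔ ⊔ s1 = s1
s⅔ ⊔ y  = s⅔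
s1 ⊔ y  = s1

neg : S6 → S6
neg s0 = s1
neg s⅓ = s⅔
neg sN = sN
neg sB = sB
neg s⅔ = s⅓
neg s1 = s0

nab : S6 → S6
nab s0 = s0
nab _  = s1

-- Homomorphisms Formula → S6 are determined by valuations ℕ → S6

⟦_⟧ : Formula → (ℕ → S6) → S6
⟦ var n ⟧ v = v n
⟦ a ∧ b ⟧ v = ⟦ a ⟧ v ⊓ ⟦ b ⟧ v
⟦ a ∨ b ⟧ v = ⟦ a ⟧ v ⊔ ⟦ b ⟧ v
⟦ ¬ a ⟧ v   = neg (⟦ a ⟧ v)
⟦ ∇ a ⟧ v   = nab (⟦ a ⟧ v)
⟦ ⊥f ⟧ v    = s0
⟦ ⊤f ⟧ v    = s1

⟦⋀_⟧ : List Formula → (ℕ → S6) → S6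
⟦⋀ Γ ⟧ v = foldr (λ a r → ⟦ a ⟧ v ⊓ r) s1 Γ

⟦⋁_⟧ : List Formula → (ℕ → S6) → S6
⟦⋁ Σ ⟧ v = foldr (λ a r → ⟦ a ⟧ v ⊔ r) s0 Σ

Valid : List Formula → List Formula → Set
Valid Γ Σ = ∀ (v : ℕ → S6) → ⟦⋀ Γ ⟧ v ≤S ⟦⋁ Σ ⟧ v

-- Sequents: Γ, Σ are finite SETS of formulas, represented by lists
-- taken up to set equality (same members), see rule `set-eq`.

_≈set_ : List Formula → List Formula → Set
Γ ≈set Δ = ∀ x → (x ∈ Γ → x ∈ Δ) × (x ∈ Δ → x ∈ Γ)

∇s : List Formula → List Formula
∇s = map ∇_

-- Derivability in the calculus 𝔖.  "Γ , α" is written α ∷ Γ.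
data _⊢_ : List Formula → List Formula → Set where
  set-eq : ∀ {Γ Γ' Σ Σ'} → Γ ⊢ Σ → Γ ≈set Γ' → Σ ≈set Σ' → Γ' ⊢ Σ'
  ax-id    : ∀ {a} → [ a ] ⊢ [ a ]
  ax-⊥     : [ ⊥f ] ⊢ []
  ax-⊤     : [] ⊢ [ ⊤f ]
  ax-∇     : ∀ {a} → [ a ] ⊢ [ ∇ a ]
  ax-∇lem  : ∀ {a} → [] ⊢ [ ∇ a ∨ ¬ ∇ a ]
  wL   : ∀ {Γ Σ a} → Γ ⊢ Σ → (a ∷ Γ) ⊢ Σ
  wR   : ∀ {Γ Σ a} → Γ ⊢ Σ → Γ ⊢ (a ∷ Σ)
  cut  : ∀ {Γ Σ a} → Γ ⊢ (a ∷ Σ) → (a ∷ Γ) ⊢ Σ → Γ ⊢ Σ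
  ∧L   : ∀ {Γ Σ a b} → (a ∷ b ∷ Γ) ⊢ Σ → ((a ∧ b) ∷ Γ) ⊢ Σ
  ∧R   : ∀ {Γ Σ a b} → Γ ⊢ (a ∷ Σ) → Γ ⊢ (b ∷ Σ) → Γ ⊢ ((a ∧ b) ∷ Σ)
  ∨L   : ∀ {Γ Σ a b} → (a ∷ Γ) ⊢ Σ → (b ∷ Γ) ⊢ Σ → ((a ∨ b) ∷ Γ) ⊢ Σ
  ∨R   : ∀ {Γ Σ a b} → Γ ⊢ (a ∷ b ∷ Σ) → Γ ⊢ ((a ∨ b) ∷ Σ)
  negR : ∀ {a b} → [ a ] ⊢ [ b ] → [ ¬ b ] ⊢ [ ¬ a ]
  ¬¬L  : ∀ {Γ Σ a} → (a ∷ Γ) ⊢ Σ → ((¬ ¬ a) ∷ Γ) ⊢ Σ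
  ¬¬R  : ∀ {Γ Σ a} → Γ ⊢ (a ∷ Σ) → Γ ⊢ ((¬ ¬ a) ∷ Σ)
  ∇rule : ∀ {Γ Σ a} → (a ∷ Γ) ⊢ ∇s Σ → ((∇ a) ∷ Γ) ⊢ ∇s Σ
  ¬∇L  : ∀ {Γ Σ a} → ((¬ ∇ a) ∷ Γ) ⊢ Σ → ((∇ ¬ ∇ a) ∷ Γ) ⊢ Σ

{-# OPTIONS --safe #-}

-- Each rule preserves validity because of an algebraic law of S6: it is a bounded
-- distributive lattice (cut, ∧, ∨, weakening), ¬ is an antitone involution, and ∇ takes
-- only the values 0 and 1 while 0 is meet-irreducible, which makes the ∇ rule sound
-- when the succedent is built from ∇-formulas. All these laws involve at most three
-- elements and are verified by evaluating them on the six elements of S6.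

module Submission where

open import Defs
open import Function using (_∘_)
open import Data.Fin using (Fin; zero; suc)
import Data.Fin.Properties as Fin
open import Data.List using (List; []; _∷_; foldr)
open import Data.List.Membership.Propositional using (_∈_)
open import Data.List.Relation.Binary.Subset.Propositional using (_⊆_)
open import Data.List.Relation.Unary.All as All using (all?)
open import Data.List.Relation.Unary.Any using (here; there)
open import Data.Product using (proj₁)
open import Level using (0ℓ)
open import Relation.Binary.Bundles using (Preorder)
open import Relation.Binary.Definitions using (DecidableEquality; Decidable; Transitive)
open import Relation.Binary.PropositionalEquality
  using (_≡_; refl; sym; trans; cong; isEquivalence)
open import Relation.Nullary.Decidable using (Dec; yes; no; map′; from-yes; _→-dec_)
import Relation.Unary as U
import Relation.Binary.Reasoning.Preorder

elements : List S6
elements = s0 ∷ s⅓ ∷ sN ∷ sB ∷ s⅔ ∷ s1 ∷ []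

∈-elements : ∀ x → x ∈ elements
∈-elements s0 = here refl
∈-elements s⅓ = there (here refl)
∈-elements sN = there (there (here refl))
∈-elements sB = there (there (there (here refl)))
∈-elements s⅔ = there (there (there (there (here refl))))
∈-elements s1 = there (there (there (there (there (here refl)))))

∀? : {P : S6 → Set} → U.Decidable P → Dec (∀ x → P x)
∀? P? = map′ (λ ps x → All.lookup ps (∈-elements x)) (λ p → All.tabulate (λ {x} _ → p x))
             (all? P? elements)

index : S6 → Fin 6
index s0 = zero
index s⅓ = suc zero
index sN = suc (suc zero)
index sB = suc (suc (suc zero))
index s⅔ = suc (suc (suc (suc zero)))
index s1 = suc (suc (suc (suc (suc zero))))

fromIndex : Fin 6 → S6
fromIndex zero                                = s0
fromIndex (suc zero)                          = s⅓
fromIndex (suc (suc zero))                    = sN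
fromIndex (suc (suc (suc zero)))              = sB
fromIndex (suc (suc (suc (suc zero))))        = s⅔
fromIndex (suc (suc (suc (suc (suc zero)))))  = s1

fromIndex-index : ∀ x → fromIndex (index x) ≡ x
fromIndex-index s0 = refl
fromIndex-index s⅓ = refl
fromIndex-index sN = refl
fromIndex-index sB = refl
fromIndex-index s⅔ = refl
fromIndex-index s1 = refl

index-injective : ∀ {x y} → index x ≡ index y → x ≡ y
index-injective {x} {y} eq =
  trans (sym (fromIndex-index x)) (trans (cong fromIndex eq) (fromIndex-index y))

infix 4 _≟_ _≤?_

_≟_ : DecidableEquality S6
x ≟ y = map′ index-injective (cong index) (index x Fin.≟ index y)

_≤?_ : Decidable _≤S_
s0 ≤? s0 = yes refl≤
s0 ≤? s⅓ = yes 0≤⅓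
s0 ≤? sN = yes 0≤N
s0 ≤? sB = yes 0≤B
s0 ≤? s⅔ = yes 0≤⅔
s0 ≤? s1 = yes 0≤1
s⅓ ≤? s0 = no λ ()
s⅓ ≤? s⅓ = yes refl≤
s⅓ ≤? sN = yes ⅓≤N
s⅓ ≤? sB = yes ⅓≤B
s⅓ ≤? s⅔ = yes ⅓≤⅔
s⅓ ≤? s1 = yes ⅓≤1
sN ≤? s0 = no λ ()
sN ≤? s⅓ = no λ ()
sN ≤? sN = yes refl≤
sN ≤? sB = no λ ()
sN ≤? s⅔ = yes N≤⅔
sN ≤? s1 = yes N≤1
sB ≤? s0 = no λ ()
sB ≤? s⅓ = no λ ()
sB ≤? sN = no λ ()
sB ≤? sB = yes refl≤
sB ≤? s⅔ = yes B≤⅔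
sB ≤? s1 = yes B≤1
s⅔ ≤? s0 = no λ ()
s⅔ ≤? s⅓ = no λ ()
s⅔ ≤? sN = no λ ()
s⅔ ≤? sB = no λ ()
s⅔ ≤? s⅔ = yes refl≤
s⅔ ≤? s1 = yes ⅔≤1
s1 ≤? s0 = no λ ()
s1 ≤? s⅓ = no λ ()
s1 ≤? sN = no λ ()
s1 ≤? sB = no λ ()
s1 ≤? s⅔ = no λ ()
s1 ≤? s1 = yes refl≤

≤-trans : Transitive _≤S_
≤-trans {x} {y} {z} =
  from-yes (∀? λ x → ∀? λ y → ∀? λ z → x ≤? y →-dec y ≤? z →-dec x ≤? z) x y z

≤-reflexive : ∀ {x y} → x ≡ y → x ≤S y
≤-reflexive refl = refl≤

≤-preorder : Preorder 0ℓ 0ℓ 0ℓ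
≤-preorder = record
  { Carrier    = S6
  ; _≈_        = _≡_
  ; _≲_        = _≤S_
  ; isPreorder = record
    { isEquivalence = isEquivalence
    ; reflexive     = ≤-reflexive
    ; trans         = ≤-trans
    }
  }

module ≤-Reasoning = Relation.Binary.Reasoning.Preorder ≤-preorder

≤-top : ∀ x → x ≤S s1
≤-top = from-yes (∀? λ x → x ≤? s1)

≤-bottom : ∀ x → s0 ≤S x
≤-bottom = from-yes (∀? λ x → s0 ≤? x)

⊓-lowerˡ : ∀ x y → (x ⊓ y) ≤S x
⊓-lowerˡ = from-yes (∀? λ x → ∀? λ y → x ⊓ y ≤? x)

⊓-lowerʳ : ∀ x y → (x ⊓ y) ≤S y
⊓-lowerʳ = from-yes (∀? λ x → ∀? λ y → x ⊓ y ≤? y)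

⊓-glb : ∀ {x y z} → z ≤S x → z ≤S y → z ≤S (x ⊓ y)
⊓-glb {x} {y} {z} =
  from-yes (∀? λ x → ∀? λ y → ∀? λ z → z ≤? x →-dec z ≤? y →-dec z ≤? x ⊓ y) x y z

⊔-upperˡ : ∀ x y → x ≤S (x ⊔ y)
⊔-upperˡ = from-yes (∀? λ x → ∀? λ y → x ≤? x ⊔ y)

⊔-upperʳ : ∀ x y → y ≤S (x ⊔ y)
⊔-upperʳ = from-yes (∀? λ x → ∀? λ y → y ≤? x ⊔ y)

⊔-lub : ∀ {x y z} → x ≤S z → y ≤S z → (x ⊔ y) ≤S z
⊔-lub {x} {y} {z} =
  from-yes (∀? λ x → ∀? λ y → ∀? λ z → x ≤? z →-dec y ≤? z →-dec x ⊔ y ≤? z) x y z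

⊓-identityʳ : ∀ x → x ⊓ s1 ≡ x
⊓-identityʳ = from-yes (∀? λ x → x ⊓ s1 ≟ x)

⊔-identityʳ : ∀ x → x ⊔ s0 ≡ x
⊔-identityʳ = from-yes (∀? λ x → x ⊔ s0 ≟ x)

⊓-assoc : ∀ x y z → (x ⊓ y) ⊓ z ≡ x ⊓ (y ⊓ z)
⊓-assoc = from-yes (∀? λ x → ∀? λ y → ∀? λ z → (x ⊓ y) ⊓ z ≟ x ⊓ (y ⊓ z))

⊔-assoc : ∀ x y z → (x ⊔ y) ⊔ z ≡ x ⊔ (y ⊔ z)
⊔-assoc = from-yes (∀? λ x → ∀? λ y → ∀? λ z → (x ⊔ y) ⊔ z ≟ x ⊔ (y ⊔ z))

⊓-distribʳ-⊔ : ∀ x y z → (y ⊔ z) ⊓ x ≡ (y ⊓ x) ⊔ (z ⊓ x)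
⊓-distribʳ-⊔ = from-yes (∀? λ x → ∀? λ y → ∀? λ z → (y ⊔ z) ⊓ x ≟ (y ⊓ x) ⊔ (z ⊓ x))

⊔-distribʳ-⊓ : ∀ x y z → (y ⊓ z) ⊔ x ≡ (y ⊔ x) ⊓ (z ⊔ x)
⊔-distribʳ-⊓ = from-yes (∀? λ x → ∀? λ y → ∀? λ z → (y ⊓ z) ⊔ x ≟ (y ⊔ x) ⊓ (z ⊔ x))

neg-involutive : ∀ x → neg (neg x) ≡ x
neg-involutive = from-yes (∀? λ x → neg (neg x) ≟ x)

neg-antitone : ∀ {x y} → x ≤S y → neg y ≤S neg x
neg-antitone {x} {y} = from-yes (∀? λ x → ∀? λ y → x ≤? y →-dec neg y ≤? neg x) x y

≤-nab : ∀ x → x ≤S nab x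
≤-nab = from-yes (∀? λ x → x ≤? nab x)

nab-excluded-middle : ∀ x → nab x ⊔ neg (nab x) ≡ s1
nab-excluded-middle = from-yes (∀? λ x → nab x ⊔ neg (nab x) ≟ s1)

-- The fixed points of nab are the two Boolean values s0 and s1.

nab-idem : ∀ x → nab (nab x) ≡ nab x
nab-idem = from-yes (∀? λ x → nab (nab x) ≟ nab x)

nab-neg-nab : ∀ x → nab (neg (nab x)) ≡ neg (nab x)
nab-neg-nab = from-yes (∀? λ x → nab (neg (nab x)) ≟ neg (nab x))

nab-fixed-⊔ : ∀ {x y} → nab x ≡ x → nab y ≡ y → nab (x ⊔ y) ≡ x ⊔ y
nab-fixed-⊔ {x} {y} =
  from-yes (∀? λ x → ∀? λ y → nab x ≟ x →-dec nab y ≟ y →-dec nab (x ⊔ y) ≟ x ⊔ y) x y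

-- Holds because every non-zero element of S6 lies above ⅓, so a meet is s0 only if
-- one of its arguments is.
nab-⊓-≤-fixed : ∀ x y {c} → nab c ≡ c → (x ⊓ y) ≤S c → (nab x ⊓ y) ≤S c
nab-⊓-≤-fixed x y {c} =
  from-yes (∀? λ x → ∀? λ y → ∀? λ c →
    nab c ≟ c →-dec x ⊓ y ≤? c →-dec nab x ⊓ y ≤? c) x y c

-- ⟦⋀ Γ ⟧ v and ⟦⋁ Σ ⟧ v are, definitionally, ⨅ (λ a → ⟦ a ⟧ v) Γ and ⨆ (λ a → ⟦ a ⟧ v) Σ.
⨅ : {A : Set} → (A → S6) → List A → S6
⨅ f = foldr (λ a r → f a ⊓ r) s1

⨆ : {A : Set} → (A → S6) → List A → S6
⨆ f = foldr (λ a r → f a ⊔ r) s0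

module _ {A : Set} (f : A → S6) where

  ⨅-lower : ∀ {x xs} → x ∈ xs → ⨅ f xs ≤S f x
  ⨅-lower {xs = y ∷ xs} (here refl) = ⊓-lowerˡ (f y) (⨅ f xs)
  ⨅-lower {xs = y ∷ xs} (there p)   = ≤-trans (⊓-lowerʳ (f y) (⨅ f xs)) (⨅-lower p)

  ⨅-greatest : ∀ {z} xs → (∀ {x} → x ∈ xs → z ≤S f x) → z ≤S ⨅ f xs
  ⨅-greatest []       _ = ≤-top _
  ⨅-greatest (x ∷ xs) h = ⊓-glb (h (here refl)) (⨅-greatest xs (h ∘ there))

  ⨅-antitone : ∀ {xs ys} → xs ⊆ ys → ⨅ f ys ≤S ⨅ f xs
  ⨅-antitone {xs} xs⊆ys = ⨅-greatest xs (⨅-lower ∘ xs⊆ys)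

  ⨆-upper : ∀ {x xs} → x ∈ xs → f x ≤S ⨆ f xs
  ⨆-upper {xs = y ∷ xs} (here refl) = ⊔-upperˡ (f y) (⨆ f xs)
  ⨆-upper {xs = y ∷ xs} (there p)   = ≤-trans (⨆-upper p) (⊔-upperʳ (f y) (⨆ f xs))

  ⨆-least : ∀ {z} xs → (∀ {x} → x ∈ xs → f x ≤S z) → ⨆ f xs ≤S z
  ⨆-least []       _ = ≤-bottom _
  ⨆-least (x ∷ xs) h = ⊔-lub (h (here refl)) (⨆-least xs (h ∘ there))

  ⨆-monotone : ∀ {xs ys} → xs ⊆ ys → ⨆ f xs ≤S ⨆ f ys
  ⨆-monotone {xs} xs⊆ys = ⨆-least xs (⨆-upper ∘ xs⊆ys)

≈set⇒⊆ : ∀ {Γ Δ} → Γ ≈set Δ → Γ ⊆ Δ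
≈set⇒⊆ Γ≈Δ {x} = proj₁ (Γ≈Δ x)

nab-fixed-⋁∇s : ∀ Σ v → nab (⟦⋁ ∇s Σ ⟧ v) ≡ ⟦⋁ ∇s Σ ⟧ v
nab-fixed-⋁∇s []      v = refl
nab-fixed-⋁∇s (b ∷ Σ) v = nab-fixed-⊔ (nab-idem (⟦ b ⟧ v)) (nab-fixed-⋁∇s Σ v)

singleton-sound : ∀ {x y} → x ≤S y → (x ⊓ s1) ≤S (y ⊔ s0)
singleton-sound {x} {y} rewrite ⊓-identityʳ x | ⊔-identityʳ y = λ x≤y → x≤y

negR-sound : ∀ {x y} → (x ⊓ s1) ≤S (y ⊔ s0) → (neg y ⊓ s1) ≤S (neg x ⊔ s0)
negR-sound {x} {y} rewrite ⊓-identityʳ x | ⊔-identityʳ y = singleton-sound ∘ neg-antitone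

cut-sound : ∀ {g a s} → g ≤S (a ⊔ s) → (a ⊓ g) ≤S s → g ≤S s
cut-sound {g} {a} {s} g≤a⊔s a⊓g≤s = begin
  g                    ≲⟨ ⊓-glb g≤a⊔s refl≤ ⟩
  (a ⊔ s) ⊓ g          ≡⟨ ⊓-distribʳ-⊔ g a s ⟩
  (a ⊓ g) ⊔ (s ⊓ g)    ≲⟨ ⊔-lub a⊓g≤s (⊓-lowerˡ s g) ⟩
  s                    ∎
  where open ≤-Reasoning

∨L-sound : ∀ a b g {s} → (a ⊓ g) ≤S s → (b ⊓ g) ≤S s → ((a ⊔ b) ⊓ g) ≤S s
∨L-sound a b g {s} a⊓g≤s b⊓g≤s = begin
  (a ⊔ b) ⊓ g          ≡⟨ ⊓-distribʳ-⊔ g a b ⟩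
  (a ⊓ g) ⊔ (b ⊓ g)    ≲⟨ ⊔-lub a⊓g≤s b⊓g≤s ⟩
  s                    ∎
  where open ≤-Reasoning

∧R-sound : ∀ a b s {g} → g ≤S (a ⊔ s) → g ≤S (b ⊔ s) → g ≤S ((a ⊓ b) ⊔ s)
∧R-sound a b s {g} g≤a⊔s g≤b⊔s = begin
  g                    ≲⟨ ⊓-glb g≤a⊔s g≤b⊔s ⟩
  (a ⊔ s) ⊓ (b ⊔ s)    ≡⟨ ⊔-distribʳ-⊓ s a b ⟨
  (a ⊓ b) ⊔ s          ∎
  where open ≤-Reasoning

sound : ∀ {Γ Σ} → Γ ⊢ Σ → Valid Γ Σ
sound (set-eq d Γ≈Γ' Σ≈Σ') v =
  ≤-trans (⨅-antitone _ (≈set⇒⊆ Γ≈Γ')) (≤-trans (sound d v) (⨆-monotone _ (≈set⇒⊆ Σ≈Σ')))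
sound ax-id v             = singleton-sound refl≤
sound ax-⊥ v              = refl≤
sound ax-⊤ v              = refl≤
sound (ax-∇ {a}) v        = singleton-sound (≤-nab (⟦ a ⟧ v))
sound (ax-∇lem {a}) v     = ≤-reflexive (cong (_⊔ s0) (sym (nab-excluded-middle (⟦ a ⟧ v))))
sound (wL d) v            = ≤-trans (⊓-lowerʳ _ _) (sound d v)
sound (wR d) v            = ≤-trans (sound d v) (⊔-upperʳ _ _)
sound (cut d e) v         = cut-sound (sound d v) (sound e v)
sound (∧L {Γ} {a = a} {b} d) v =
  ≤-trans (≤-reflexive (⊓-assoc (⟦ a ⟧ v) (⟦ b ⟧ v) (⟦⋀ Γ ⟧ v))) (sound d v)
sound (∧R {Σ = Σ} {a} {b} d e) v =
  ∧R-sound (⟦ a ⟧ v) (⟦ b ⟧ v) (⟦⋁ Σ ⟧ v) (sound d v) (sound e v)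
sound (∨L {Γ} {a = a} {b} d e) v =
  ∨L-sound (⟦ a ⟧ v) (⟦ b ⟧ v) (⟦⋀ Γ ⟧ v) (sound d v) (sound e v)
sound (∨R {Σ = Σ} {a} {b} d) v =
  ≤-trans (sound d v) (≤-reflexive (sym (⊔-assoc (⟦ a ⟧ v) (⟦ b ⟧ v) (⟦⋁ Σ ⟧ v))))
sound (negR d) v          = negR-sound (sound d v)
sound (¬¬L {Γ} {a = a} d) v =
  ≤-trans (≤-reflexive (cong (_⊓ ⟦⋀ Γ ⟧ v) (neg-involutive (⟦ a ⟧ v)))) (sound d v)
sound (¬¬R {Σ = Σ} {a} d) v =
  ≤-trans (sound d v) (≤-reflexive (cong (_⊔ ⟦⋁ Σ ⟧ v) (sym (neg-involutive (⟦ a ⟧ v)))))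
sound (∇rule {Γ} {Σ} {a} d) v =
  nab-⊓-≤-fixed (⟦ a ⟧ v) (⟦⋀ Γ ⟧ v) (nab-fixed-⋁∇s Σ v) (sound d v)
sound (¬∇L {Γ} {a = a} d) v =
  ≤-trans (≤-reflexive (cong (_⊓ ⟦⋀ Γ ⟧ v) (nab-neg-nab (⟦ a ⟧ v)))) (sound d v)

mainTheorem17 : ∀ (Γ Σ : List Formula) → Γ ⊢ Σ → Valid Γ Σ
mainTheorem17 _ _ = sound
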